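{- Let $x,y,k$ be positive integers with $k\ge3$. Let $\overrightarrow{C}$ be a directed cycle of length $n$ in $\overrightarrow{C}_{(x:k)}$ and $\overrightarrow{C}'$ a directed cycle of length $m$ in $\overrightarrow{C}_{(y:k)}$, each regarded as a spanning subgraph (all vertices not on the cycle being isolated). Then $\overrightarrow{C}\otimes\overrightarrow{C}'$ consists of $\frac{\gcd(n,m)}{k}$ vertex-disjoint directed cycles of length $\frac{nm}{\gcd(n,m)}$ together with $xyk-\frac{nm}{k}$ isolated vertices, as a subgraph of $\overrightarrow{C}_{(xy:k)}$.
   Context: For positive integers $v$ and $k\ge3$, $\overrightarrow{C}_{(v:k)}$ has vertex set $\{(g,i):0\le g\le v-1,\ i\in\mathbb{Z}_k\}$ and arcs $((g,i),(h,i+1))$ for all $g,h$, $i$; vertices $(g,i)$ with fixed $i$ form part $i$. For directed $k$-partite graphs $G,H$ whose vertices are written $(g,i)$, $(h,i)$ with $i$ the part index, the partite product $G\otimes H$ has vertex set $\{(g,h,i):(g,i)\in V(G),(h,i)\in V(H)\}$ and an arc from $(g_1,h_1,i)$ to $(g_2,h_2,j)$ iff $((g_1,i),(g_2,j))$ is an arc of $G$ and $((h_1,i),(h_2,j))$ is an arc of $H$. Under this identification $\overrightarrow{C}_{(x:k)}\otimes\overrightarrow{C}_{(y:k)}\cong\overrightarrow{C}_{(xy:k)}$. -}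

module Defs where

open import Data.Nat using (ℕ; zero; suc; NonZero; _%_)
open import Data.Nat.DivMod using (m%n<n)
open import Data.Fin using (Fin; toℕ; fromℕ<)
open import Data.Product using (_×_; _,_; ∃)
open import Function.Definitions using (Injective)
open import Relation.Binary.PropositionalEquality using (_≡_)

next : ∀ {n} → Fin n → Fin n
next {suc n} i = fromℕ< (m%n<n (suc (toℕ i)) (suc n))

-- vertices of C_(v:k): pairs (g , i) with g < v and i ∈ ℤ_k (= Fin k)
Vtx : ℕ → ℕ → Set
Vtx v k = Fin v × Fin k

Arc : ∀ {v k} → Vtx v k → Vtx v k → Set
Arc {v} {k} (g , i) (h , j) = j ≡ next i

record DiCycle (v k n : ℕ) : Set where
  field
    ⦃ nonZero ⦄ : NonZero n
    vert   : Fin n → Vtx v k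
    inj    : Injective _≡_ _≡_ vert
    isArc  : ∀ j → Arc (vert j) (vert (next j))
open DiCycle public

CycArc : ∀ {v k n} → DiCycle v k n → Vtx v k → Vtx v k → Set
CycArc C u w = ∃ λ j → u ≡ vert C j × w ≡ vert C (next j)

PVtx : ℕ → ℕ → ℕ → Set
PVtx x y k = Fin x × Fin y × Fin k

ProdArc : ∀ {x y k n m} → DiCycle x k n → DiCycle y k m →
          PVtx x y k → PVtx x y k → Set
ProdArc C C' (g₁ , h₁ , i) (g₂ , h₂ , j) =
  CycArc C (g₁ , i) (g₂ , j) × CycArc C' (h₁ , i) (h₂ , j)

-- Number the vertices of C by ℕ through walk t = vert C (t mod n), and likewise walk′ for C′.
-- A walk advances one part per step, so k divides n and m, and walk a, walk′ b lie in the same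
-- part exactly when a ≡ c₀ + b (mod k) for a fixed offset c₀.  Hence every arc of C ⊗ C′ lies on
-- one of the orbits t ↦ (walk (c₀ + s k + t), walk′ t), each of period lcm n m.  The orbits with
-- s < d = gcd n m / k are pairwise disjoint, because two of them can only meet when their values
-- s k agree modulo gcd n m, and they carry every arc by Bézout's identity: modulo n, the
-- multiples of m are exactly the multiples of gcd n m.  This accounts for d · lcm n m = n m / k
-- vertices; the remaining ones are isolated.

module Submission where

open import Defs
open import Data.Nat using (ℕ; _+_; _*_; _≤_)
open import Data.Nat.GCD using (gcd)
open import Data.Fin using (Fin)
open import Data.Product using (_×_; _,_; ∃; ∃₂)
open import Data.Sum using (_⊎_; inj₁; inj₂)
open import Function.Bundles using (_⤖_; Bijection)
open import Relation.Binary.PropositionalEquality using (_≡_)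

open import Data.Nat using (zero; suc; pred; _∸_; _<_; NonZero; _%_; _/_; z≤n; s≤s; ≢-nonZero; ≢-nonZero⁻¹; >-nonZero)
open import Data.Nat.Properties
  using ( +-identityʳ; +-assoc; +-comm; +-suc; +-cancelˡ-≡; m+[n∸m]≡n; m+n∸n≡m; ∸-+-assoc; [m+n]∸[m+o]≡n∸o
        ; *-distribʳ-∸; *-assoc; *-comm; *-monoˡ-<; *-cancelʳ-≡; m*n≢0; m*n≢0⇒m≢0; m*n≢0⇒n≢0
        ; suc-pred; ≤-total; ≤-trans )
open import Data.Nat.DivMod using (_mod_; m≡m%n+[m/n]*n; [m+kn]%n≡m%n; m<n⇒m%n≡m; m%n<n)
open import Data.Nat.Divisibility using (_∣_; divides; divides-refl; quotient; ∣-trans)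
open import Data.Nat.GCD using (gcd[m,n]∣m; gcd[m,n]∣n; gcd[m,n]≢0; gcd-GCD; gcd-greatest; module Bézout)
open import Data.Nat.LCM using (lcm; lcm-least; m∣lcm[m,n]; n∣lcm[m,n]; gcd*lcm)
open import Data.Nat.Tactic.RingSolver using (solve-∀)
open import Data.Fin using (zero; suc; toℕ; fromℕ<)
open import Data.Fin.Properties using (toℕ-fromℕ<; toℕ-injective; toℕ<n; suc-injective; 0≢1+n; +↔⊎; *↔×)
open import Data.Fin.Permutation using (transpose)
open import Data.Product using (Σ; proj₁; proj₂)
open import Data.Product.Function.NonDependent.Propositional using (_×-cong_)
open import Data.Sum.Function.Propositional using (_⊎-cong_)
open import Function using (_∘_)
open import Function.Bundles using (_↔_; Inverse; Injection)
open import Function.Definitions using (Injective)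
open import Function.Properties.Inverse using (↔-refl; ↔-sym; ↔-trans; ↔⇒↣; ↔⇒⤖)
open import Function.Related.Propositional using (module EquationalReasoning)
open import Function.Related.TypeIsomorphisms using (⊎-assoc; ⊎-comm; Σ-assoc)
open import Level using (0ℓ)
open import Relation.Binary.Bundles using (Setoid)
open import Relation.Binary.PropositionalEquality
open import Relation.Nullary using (contradiction)

infix 4 _≡_modulo_

data _≡_modulo_ (a b n : ℕ) : Set where
  congruent : ∀ u v → a + u * n ≡ b + v * n → a ≡ b modulo n

module _ {n : ℕ} where

  ≡-mod-reflexive : ∀ {a b} → a ≡ b → a ≡ b modulo n
  ≡-mod-reflexive refl = congruent 0 0 refl

  ≡-mod-refl : ∀ {a} → a ≡ a modulo n
  ≡-mod-refl = ≡-mod-reflexive refl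

  ≡-mod-sym : ∀ {a b} → a ≡ b modulo n → b ≡ a modulo n
  ≡-mod-sym (congruent u v e) = congruent v u (sym e)

  ≡-mod-trans : ∀ {a b c} → a ≡ b modulo n → b ≡ c modulo n → a ≡ c modulo n
  ≡-mod-trans {a} {b} {c} (congruent u v e) (congruent u′ v′ e′) = congruent (u + u′) (v′ + v) (begin
    a + (u + u′) * n     ≡⟨ shift a u u′ n ⟩
    a + u * n + u′ * n   ≡⟨ cong (_+ u′ * n) e ⟩
    b + v * n + u′ * n   ≡⟨ swap b v u′ n ⟩
    b + u′ * n + v * n   ≡⟨ cong (_+ v * n) e′ ⟩
    c + v′ * n + v * n   ≡⟨ shift c v′ v n ⟨
    c + (v′ + v) * n     ∎)
    where
    open ≡-Reasoning
    shift : ∀ a u u′ n → a + (u + u′) * n ≡ a + u * n + u′ * n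
    shift = solve-∀
    swap : ∀ b v u′ n → b + v * n + u′ * n ≡ b + u′ * n + v * n
    swap = solve-∀

  ≡-mod-+-cong : ∀ {a b c d} → a ≡ b modulo n → c ≡ d modulo n → a + c ≡ b + d modulo n
  ≡-mod-+-cong {a} {b} {c} {d} (congruent u v e) (congruent u′ v′ e′) = congruent (u + u′) (v + v′) (begin
    a + c + (u + u′) * n         ≡⟨ regroup a c u u′ n ⟩
    (a + u * n) + (c + u′ * n)   ≡⟨ cong₂ _+_ e e′ ⟩
    (b + v * n) + (d + v′ * n)   ≡⟨ regroup b d v v′ n ⟨
    b + d + (v + v′) * n         ∎)
    where
    open ≡-Reasoning
    regroup : ∀ a c u u′ n → a + c + (u + u′) * n ≡ (a + u * n) + (c + u′ * n)
    regroup = solve-∀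

  ≡-mod-+-congˡ : ∀ a {b c} → b ≡ c modulo n → a + b ≡ a + c modulo n
  ≡-mod-+-congˡ a = ≡-mod-+-cong (≡-mod-refl {a})

  ≡-mod-+-cancelˡ : ∀ a {b c} → a + b ≡ a + c modulo n → b ≡ c modulo n
  ≡-mod-+-cancelˡ a {b} {c} (congruent u v e) =
    congruent u v (+-cancelˡ-≡ a _ _ (trans (sym (+-assoc a b (u * n))) (trans e (+-assoc a c (v * n)))))

  ≡-mod-*-congˡ : ∀ w {a b} → a ≡ b modulo n → w * a ≡ w * b modulo n
  ≡-mod-*-congˡ w {a} {b} (congruent u v e) = congruent (w * u) (w * v) (begin
    w * a + w * u * n   ≡⟨ distrib w a u n ⟩
    w * (a + u * n)     ≡⟨ cong (w *_) e ⟩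
    w * (b + v * n)     ≡⟨ distrib w b v n ⟨
    w * b + w * v * n   ∎)
    where
    open ≡-Reasoning
    distrib : ∀ w a u n → w * a + w * u * n ≡ w * (a + u * n)
    distrib = solve-∀

  m*n≡0-mod : ∀ a → a * n ≡ 0 modulo n
  m*n≡0-mod a = congruent 0 a (+-identityʳ (a * n))

  ∣∸⇒≡-mod : ∀ {a b} → a ≤ b → n ∣ b ∸ a → a ≡ b modulo n
  ∣∸⇒≡-mod {a} {b} a≤b (divides q eq) = congruent q 0 (begin
    a + q * n         ≡⟨ cong (a +_) eq ⟨
    a + (b ∸ a)       ≡⟨ m+[n∸m]≡n a≤b ⟩
    b                 ≡⟨ +-identityʳ b ⟨
    b + 0 * n         ∎)
    where open ≡-Reasoning

  ≡-mod⇒∣∸ : ∀ {a b} → a ≡ b modulo n → a ≤ b → n ∣ b ∸ a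
  ≡-mod⇒∣∸ {a} {b} (congruent u v e) a≤b = divides (u ∸ v) (begin
    b ∸ a                       ≡⟨ cong (_∸ a) (m+n∸n≡m b (v * n)) ⟨
    b + v * n ∸ v * n ∸ a       ≡⟨ ∸-+-assoc (b + v * n) (v * n) a ⟩
    b + v * n ∸ (v * n + a)     ≡⟨ cong₂ _∸_ (sym e) (+-comm (v * n) a) ⟩
    a + u * n ∸ (a + v * n)     ≡⟨ [m+n]∸[m+o]≡n∸o a (u * n) (v * n) ⟩
    u * n ∸ v * n               ≡⟨ *-distribʳ-∸ n u v ⟨
    (u ∸ v) * n                 ∎)
    where open ≡-Reasoning

  ≡-mod-∣ : ∀ {d a b} → d ∣ n → a ≡ b modulo n → a ≡ b modulo d
  ≡-mod-∣ {d} {a} {b} (divides-refl q) (congruent u v e) =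
    congruent (u * q) (v * q) (trans (cong (a +_) (*-assoc u q d)) (trans e (cong (b +_) (sym (*-assoc v q d)))))

  module _ .⦃ _ : NonZero n ⦄ where

    %-≡-mod : ∀ a → a % n ≡ a modulo n
    %-≡-mod a = congruent (a / n) 0 (trans (sym (m≡m%n+[m/n]*n a n)) (sym (+-identityʳ a)))

    ≡-mod⇒%≡ : ∀ {a b} → a ≡ b modulo n → a % n ≡ b % n
    ≡-mod⇒%≡ {a} {b} (congruent u v e) =
      trans (sym ([m+kn]%n≡m%n a u n)) (trans (cong (_% n) e) ([m+kn]%n≡m%n b v n))

    %≡⇒≡-mod : ∀ {a b} → a % n ≡ b % n → a ≡ b modulo n
    %≡⇒≡-mod {a} {b} e = ≡-mod-trans (≡-mod-sym (%-≡-mod a)) (subst (_≡ b modulo n) (sym e) (%-≡-mod b))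

    ≡-mod-<⇒≡ : ∀ {a b} → a ≡ b modulo n → a < n → b < n → a ≡ b
    ≡-mod-<⇒≡ a≡b a<n b<n = trans (sym (m<n⇒m%n≡m a<n)) (trans (≡-mod⇒%≡ a≡b) (m<n⇒m%n≡m b<n))

≡-mod-lcm : ∀ {n m a b} → a ≡ b modulo n → a ≡ b modulo m → a ≡ b modulo lcm n m
≡-mod-lcm {a = a} {b} p q with ≤-total a b
... | inj₁ a≤b = ∣∸⇒≡-mod a≤b (lcm-least (≡-mod⇒∣∸ p a≤b) (≡-mod⇒∣∸ q a≤b))
... | inj₂ b≤a =
  ≡-mod-sym (∣∸⇒≡-mod b≤a (lcm-least (≡-mod⇒∣∸ (≡-mod-sym p) b≤a) (≡-mod⇒∣∸ (≡-mod-sym q) b≤a)))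

≡-mod-0⇒∣ : ∀ {n a} → a ≡ 0 modulo n → n ∣ a
≡-mod-0⇒∣ a≡0 = ≡-mod⇒∣∸ (≡-mod-sym a≡0) z≤n

modulo-setoid : ℕ → Setoid 0ℓ 0ℓ
modulo-setoid n = record
  { Carrier       = ℕ
  ; _≈_           = λ a b → a ≡ b modulo n
  ; isEquivalence = record { refl = ≡-mod-refl ; sym = ≡-mod-sym ; trans = ≡-mod-trans }
  }

module _ {n : ℕ} .⦃ _ : NonZero n ⦄ where

  open import Relation.Binary.Reasoning.Setoid (modulo-setoid n)

  +-pred-*≡0-mod : ∀ a → a + pred n * a ≡ 0 modulo n
  +-pred-*≡0-mod a = begin
    suc (pred n) * a   ≡⟨ cong (_* a) (suc-pred n) ⟩
    n * a              ≡⟨ *-comm n a ⟩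
    a * n              ≈⟨ m*n≡0-mod a ⟩
    0                  ∎

  ≡-mod-+-solvable : ∀ a b → ∃ λ c → a + c ≡ b modulo n
  ≡-mod-+-solvable a b = pred n * a + b , (begin
    a + (pred n * a + b)   ≡⟨ +-assoc a (pred n * a) b ⟨
    a + pred n * a + b     ≈⟨ ≡-mod-+-cong (+-pred-*≡0-mod a) ≡-mod-refl ⟩
    b                      ∎)

  gcd-≡-mod-multiple : ∀ m → ∃ λ t → t * m ≡ gcd n m modulo n
  gcd-≡-mod-multiple m with Bézout.identity (gcd-GCD n m)
  ... | Bézout.-+ x y eq = y , ≡-mod-sym (congruent x 0 (trans eq (sym (+-identityʳ (y * m)))))
  ... | Bézout.+- x y eq = pred n * y , (begin
    pred n * y * m                          ≡⟨ +-identityʳ _ ⟨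
    pred n * y * m + 0                      ≈⟨ ≡-mod-+-congˡ (pred n * y * m) (m*n≡0-mod x) ⟨
    pred n * y * m + x * n                  ≡⟨ cong (pred n * y * m +_) eq ⟨
    pred n * y * m + (gcd n m + y * m)      ≡⟨ rearrange (pred n) y m (gcd n m) ⟩
    gcd n m + (y * m + pred n * (y * m))    ≈⟨ ≡-mod-+-congˡ (gcd n m) (+-pred-*≡0-mod (y * m)) ⟩
    gcd n m + 0                             ≡⟨ +-identityʳ (gcd n m) ⟩
    gcd n m                                 ∎)
    where
    rearrange : ∀ p y m g → p * y * m + (g + y * m) ≡ g + (y * m + p * (y * m))
    rearrange = solve-∀

module OrbitIndex {n m k : ℕ} .⦃ _ : NonZero n ⦄ .⦃ _ : NonZero k ⦄ (k∣g : k ∣ gcd n m) where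

  d : ℕ
  d = quotient k∣g

  g≡d*k : gcd n m ≡ d * k
  g≡d*k = _∣_.equality k∣g

  instance
    gcd-nonZero : NonZero (gcd n m)
    gcd-nonZero = ≢-nonZero (gcd[m,n]≢0 n m (inj₁ (≢-nonZero⁻¹ n)))

    d-nonZero : NonZero d
    d-nonZero = m*n≢0⇒m≢0 d ⦃ subst NonZero g≡d*k gcd-nonZero ⦄

  orbit-index-injective : ∀ c {s s′ t t′} → s < d → s′ < d →
    c + s * k + t ≡ c + s′ * k + t′ modulo n → t ≡ t′ modulo m →
    s ≡ s′ × (t ≡ t′ modulo lcm n m)
  orbit-index-injective c {s} {s′} {t} {t′} s<d s′<d p q = s≡s′ , ≡-mod-lcm t≡t′ q
    where
    p′ : s * k + t ≡ s′ * k + t′ modulo n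
    p′ = ≡-mod-+-cancelˡ c (subst₂ (_≡_modulo n) (+-assoc c (s * k) t) (+-assoc c (s′ * k) t′) p)

    sk≡s′k : s * k ≡ s′ * k modulo gcd n m
    sk≡s′k = ≡-mod-+-cancelˡ t (begin
      t + s * k      ≡⟨ +-comm t (s * k) ⟩
      s * k + t      ≈⟨ ≡-mod-∣ (gcd[m,n]∣m n m) p′ ⟩
      s′ * k + t′    ≈⟨ ≡-mod-+-congˡ (s′ * k) (≡-mod-∣ (gcd[m,n]∣n n m) q) ⟨
      s′ * k + t     ≡⟨ +-comm (s′ * k) t ⟩
      t + s′ * k     ∎)
      where open import Relation.Binary.Reasoning.Setoid (modulo-setoid (gcd n m))

    *k<gcd : ∀ {r} → r < d → r * k < gcd n m
    *k<gcd r<d = subst (_ <_) (sym g≡d*k) (*-monoˡ-< k r<d)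

    s≡s′ : s ≡ s′
    s≡s′ = *-cancelʳ-≡ s s′ k (≡-mod-<⇒≡ sk≡s′k (*k<gcd s<d) (*k<gcd s′<d))

    t≡t′ : t ≡ t′ modulo n
    t≡t′ = ≡-mod-+-cancelˡ (s * k) (subst (λ r → s * k + t ≡ r * k + t′ modulo n) (sym s≡s′) p′)

  orbit-index-surjective : ∀ c {α β} → α ≡ c + β modulo k →
    ∃ λ s → s < d × ∃ λ t → (c + s * k + t ≡ α modulo n) × (t ≡ β modulo m)
  orbit-index-surjective c {α} {β} α≡c+β =
    s , m%n<n e d , t , c+sk+t≡α , congruent 0 (W * t₀) (+-identityʳ t)
    where
    z = c + β
    D = proj₁ (≡-mod-+-solvable {n} z α)

    z+D≡α : z + D ≡ α modulo n
    z+D≡α = proj₂ (≡-mod-+-solvable {n} z α)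

    k∣D : k ∣ D
    k∣D = ≡-mod-0⇒∣ (≡-mod-+-cancelˡ z z+D≡z+0)
      where
      z+D≡z+0 : z + D ≡ z + 0 modulo k
      z+D≡z+0 = ≡-mod-trans (≡-mod-∣ (∣-trans k∣g (gcd[m,n]∣m n m)) z+D≡α)
                            (≡-mod-trans α≡c+β (≡-mod-reflexive (sym (+-identityʳ z))))

    e = quotient k∣D
    s = e % d
    W = e / d

    D≡sk+Wg : D ≡ s * k + W * gcd n m
    D≡sk+Wg = begin
      D                       ≡⟨ _∣_.equality k∣D ⟩
      e * k                   ≡⟨ cong (_* k) (m≡m%n+[m/n]*n e d) ⟩
      (s + W * d) * k         ≡⟨ distrib s W d k ⟩
      s * k + W * (d * k)     ≡⟨ cong (λ r → s * k + W * r) g≡d*k ⟨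
      s * k + W * gcd n m     ∎
      where
      open ≡-Reasoning
      distrib : ∀ s W d k → (s + W * d) * k ≡ s * k + W * (d * k)
      distrib = solve-∀

    t₀ = proj₁ (gcd-≡-mod-multiple {n} m)
    t = β + W * t₀ * m

    c+sk+t≡α : c + s * k + t ≡ α modulo n
    c+sk+t≡α = begin
      c + s * k + t                 ≡⟨ rearrange c β (s * k) W t₀ m ⟩
      z + (s * k + W * (t₀ * m))    ≈⟨ ≡-mod-+-congˡ z (≡-mod-+-congˡ (s * k)
                                         (≡-mod-*-congˡ W (proj₂ (gcd-≡-mod-multiple {n} m)))) ⟩
      z + (s * k + W * gcd n m)     ≡⟨ cong (z +_) D≡sk+Wg ⟨
      z + D                         ≈⟨ z+D≡α ⟩
      α                             ∎
      where
      open import Relation.Binary.Reasoning.Setoid (modulo-setoid n)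
      rearrange : ∀ c β sk W t₀ m → c + sk + (β + W * t₀ * m) ≡ c + β + (sk + W * (t₀ * m))
      rearrange = solve-∀

module _ {n : ℕ} .⦃ _ : NonZero n ⦄ where

  toℕ-mod : ∀ t → toℕ (t mod n) ≡ t % n
  toℕ-mod t = toℕ-fromℕ< _

  toℕ-mod-≡-mod : ∀ t → toℕ (t mod n) ≡ t modulo n
  toℕ-mod-≡-mod t = subst (_≡ t modulo n) (sym (toℕ-mod t)) (%-≡-mod t)

  mod-cong : ∀ {a b} → a ≡ b modulo n → a mod n ≡ b mod n
  mod-cong a≡b = toℕ-injective (trans (toℕ-mod _) (trans (≡-mod⇒%≡ a≡b) (sym (toℕ-mod _))))

  mod-injective : ∀ {a b} → a mod n ≡ b mod n → a ≡ b modulo n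
  mod-injective {a} {b} e = %≡⇒≡-mod (trans (sym (toℕ-mod a)) (trans (cong toℕ e) (toℕ-mod b)))

  mod-toℕ : ∀ (j : Fin n) → toℕ j mod n ≡ j
  mod-toℕ j = toℕ-injective (trans (toℕ-mod (toℕ j)) (m<n⇒m%n≡m (toℕ<n j)))

next≡suc-mod : ∀ {n} .⦃ _ : NonZero n ⦄ (j : Fin n) → next j ≡ suc (toℕ j) mod n
next≡suc-mod {suc n} j = refl

toℕ-next : ∀ {n} .⦃ _ : NonZero n ⦄ (j : Fin n) → toℕ (next j) ≡ suc (toℕ j) modulo n
toℕ-next {n} j =
  subst (λ i → toℕ i ≡ suc (toℕ j) modulo n) (sym (next≡suc-mod j)) (toℕ-mod-≡-mod (suc (toℕ j)))

module Walk {v k n : ℕ} .⦃ _ : NonZero k ⦄ (C : DiCycle v k n) where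

  instance
    length-nonZero : NonZero n
    length-nonZero = nonZero C

  walk : ℕ → Vtx v k
  walk t = vert C (t mod n)

  walk-cong : ∀ {a b} → a ≡ b modulo n → walk a ≡ walk b
  walk-cong a≡b = cong (vert C) (mod-cong a≡b)

  walk-injective : ∀ {a b} → walk a ≡ walk b → a ≡ b modulo n
  walk-injective e = mod-injective (inj C e)

  walk-vert : ∀ {a} {j : Fin n} → a ≡ toℕ j modulo n → walk a ≡ vert C j
  walk-vert {j = j} a≡j = trans (walk-cong a≡j) (cong (vert C) (mod-toℕ j))

  walk-suc : ∀ t → walk (suc t) ≡ vert C (next (t mod n))
  walk-suc t = cong (vert C) (trans (mod-cong suc-t≡) (sym (next≡suc-mod (t mod n))))
    where
    suc-t≡ : suc t ≡ suc (toℕ (t mod n)) modulo n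
    suc-t≡ = ≡-mod-+-congˡ 1 (≡-mod-sym (toℕ-mod-≡-mod t))

  walk-suc-vert : ∀ {a} {j : Fin n} → a ≡ toℕ j modulo n → walk (suc a) ≡ vert C (next j)
  walk-suc-vert {a} a≡j = trans (walk-suc a) (cong (λ i → vert C (next i)) (trans (mod-cong a≡j) (mod-toℕ _)))

  walk-arc : ∀ t → CycArc C (walk t) (walk (suc t))
  walk-arc t = t mod n , refl , walk-suc t

  p₀ : ℕ
  p₀ = toℕ (proj₂ (walk 0))

  part-walk : ∀ t → toℕ (proj₂ (walk t)) ≡ p₀ + t modulo k
  part-walk zero = ≡-mod-reflexive (sym (+-identityʳ p₀))
  part-walk (suc t) = begin
    toℕ (proj₂ (walk (suc t)))             ≡⟨ cong (toℕ ∘ proj₂) (walk-suc t) ⟩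
    toℕ (proj₂ (vert C (next (t mod n))))  ≡⟨ cong toℕ (isArc C (t mod n)) ⟩
    toℕ (next (proj₂ (walk t)))            ≈⟨ toℕ-next (proj₂ (walk t)) ⟩
    suc (toℕ (proj₂ (walk t)))             ≈⟨ ≡-mod-+-congˡ 1 (part-walk t) ⟩
    suc (p₀ + t)                           ≡⟨ +-suc p₀ t ⟨
    p₀ + suc t                             ∎
    where open import Relation.Binary.Reasoning.Setoid (modulo-setoid k)

  k∣length : k ∣ n
  k∣length = ≡-mod-0⇒∣ (≡-mod-+-cancelˡ p₀ (begin
    p₀ + n                  ≈⟨ part-walk n ⟨
    toℕ (proj₂ (walk n))    ≡⟨ cong (toℕ ∘ proj₂) (walk-cong (congruent 0 1 refl)) ⟩
    toℕ (proj₂ (walk 0))    ≈⟨ part-walk 0 ⟩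
    p₀ + 0                  ∎))
    where open import Relation.Binary.Reasoning.Setoid (modulo-setoid k)

infixr 5 _⊗_

-- the part index is taken from the left factor: only meaningful when both factors lie in the same part
_⊗_ : ∀ {x y k} → Vtx x k → Vtx y k → PVtx x y k
(g , i) ⊗ (h , _) = g , h , i

⊗-injective : ∀ {x y k} {u w : Vtx x k} {u′ w′ : Vtx y k} → u ⊗ u′ ≡ w ⊗ w′ →
              proj₂ u ≡ proj₂ u′ → proj₂ w ≡ proj₂ w′ → u ≡ w × u′ ≡ w′
⊗-injective {u = _ , _} {_ , _} {_ , _} {_ , _} refl refl refl = refl , refl

module Orbits {x y k n m : ℕ} .⦃ _ : NonZero k ⦄ (C : DiCycle x k n) (C′ : DiCycle y k m) where

  module W  = Walk C
  module W′ = Walk C′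
  open W using (walk)
  open W′ using () renaming (walk to walk′)
  open OrbitIndex (gcd-greatest W.k∣length W′.k∣length) public using (d; g≡d*k)
  open OrbitIndex (gcd-greatest W.k∣length W′.k∣length) using (orbit-index-injective; orbit-index-surjective)

  ⊗-arc : ∀ {u w : Vtx x k} {u′ w′ : Vtx y k} → CycArc C u w → CycArc C′ u′ w′ →
          proj₂ u ≡ proj₂ u′ → proj₂ w ≡ proj₂ w′ → ProdArc C C′ (u ⊗ u′) (w ⊗ w′)
  ⊗-arc {_ , _} {_ , _} {_ , _} {_ , _} a a′ refl refl = a , a′

  L : ℕ
  L = lcm n m

  d*k≡gcd : d * k ≡ gcd n m
  d*k≡gcd = sym g≡d*k

  L*gcd≡n*m : L * gcd n m ≡ n * m
  L*gcd≡n*m = trans (*-comm L (gcd n m)) (gcd*lcm n m)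

  d*L*k≡n*m : d * L * k ≡ n * m
  d*L*k≡n*m = begin
    d * L * k      ≡⟨ *-assoc d L k ⟩
    d * (L * k)    ≡⟨ cong (d *_) (*-comm L k) ⟩
    d * (k * L)    ≡⟨ *-assoc d k L ⟨
    d * k * L      ≡⟨ cong (_* L) d*k≡gcd ⟩
    gcd n m * L    ≡⟨ gcd*lcm n m ⟩
    n * m          ∎
    where open ≡-Reasoning

  c₀ : ℕ
  c₀ = proj₁ (≡-mod-+-solvable {k} W.p₀ W′.p₀)

  p₀+c₀≡p₀′ : W.p₀ + c₀ ≡ W′.p₀ modulo k
  p₀+c₀≡p₀′ = proj₂ (≡-mod-+-solvable {k} W.p₀ W′.p₀)

  orbit : ℕ → ℕ → PVtx x y k
  orbit s t = walk (c₀ + s * k + t) ⊗ walk′ t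

  private
    p₀′+b≡p₀+[c₀+b] : ∀ b → W′.p₀ + b ≡ W.p₀ + (c₀ + b) modulo k
    p₀′+b≡p₀+[c₀+b] b = ≡-mod-trans (≡-mod-+-cong (≡-mod-sym p₀+c₀≡p₀′) ≡-mod-refl)
                                    (≡-mod-reflexive (+-assoc W.p₀ c₀ b))

  same-part : ∀ {a b} → a ≡ c₀ + b modulo k → proj₂ (walk a) ≡ proj₂ (walk′ b)
  same-part {a} {b} a≡c₀+b = toℕ-injective (≡-mod-<⇒≡ (begin
    toℕ (proj₂ (walk a))     ≈⟨ W.part-walk a ⟩
    W.p₀ + a                 ≈⟨ ≡-mod-+-congˡ W.p₀ a≡c₀+b ⟩
    W.p₀ + (c₀ + b)          ≈⟨ p₀′+b≡p₀+[c₀+b] b ⟨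
    W′.p₀ + b                ≈⟨ W′.part-walk b ⟨
    toℕ (proj₂ (walk′ b))    ∎) (toℕ<n _) (toℕ<n _))
    where open import Relation.Binary.Reasoning.Setoid (modulo-setoid k)

  same-part⁻¹ : ∀ {a b} → proj₂ (walk a) ≡ proj₂ (walk′ b) → a ≡ c₀ + b modulo k
  same-part⁻¹ {a} {b} e = ≡-mod-+-cancelˡ W.p₀ (begin
    W.p₀ + a                 ≈⟨ W.part-walk a ⟨
    toℕ (proj₂ (walk a))     ≡⟨ cong toℕ e ⟩
    toℕ (proj₂ (walk′ b))    ≈⟨ W′.part-walk b ⟩
    W′.p₀ + b                ≈⟨ p₀′+b≡p₀+[c₀+b] b ⟩
    W.p₀ + (c₀ + b)          ∎)
    where open import Relation.Binary.Reasoning.Setoid (modulo-setoid k)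

  orbit-same-part : ∀ s t → proj₂ (walk (c₀ + s * k + t)) ≡ proj₂ (walk′ t)
  orbit-same-part s t = same-part (congruent 0 s (drop-multiple c₀ s k t))
    where
    drop-multiple : ∀ c s k t → c + s * k + t + 0 * k ≡ c + t + s * k
    drop-multiple = solve-∀

  orbit-arc : ∀ s t → ProdArc C C′ (orbit s t) (orbit s (suc t))
  orbit-arc s t = ⊗-arc arc (W′.walk-arc t) (orbit-same-part s t) (orbit-same-part s (suc t))
    where
    arc : CycArc C (walk (c₀ + s * k + t)) (walk (c₀ + s * k + suc t))
    arc = subst (CycArc C _) (cong walk (sym (+-suc (c₀ + s * k) t))) (W.walk-arc _)

  orbit-cong : ∀ s {t t′} → t ≡ t′ modulo L → orbit s t ≡ orbit s t′
  orbit-cong s t≡t′ = cong₂ _⊗_ (W.walk-cong (≡-mod-+-congˡ (c₀ + s * k) (≡-mod-∣ (m∣lcm[m,n] n m) t≡t′)))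
                                (W′.walk-cong (≡-mod-∣ (n∣lcm[m,n] n m) t≡t′))

  orbit-injective : ∀ {s s′ t t′} → s < d → s′ < d → orbit s t ≡ orbit s′ t′ → s ≡ s′ × (t ≡ t′ modulo L)
  orbit-injective {s} {s′} {t} {t′} s<d s′<d e
    with ⊗-injective e (orbit-same-part s t) (orbit-same-part s′ t′)
  ... | e₁ , e₂ = orbit-index-injective c₀ s<d s′<d (W.walk-injective e₁) (W′.walk-injective e₂)

  vert⊗vert≡orbit : ∀ {α β s t} → c₀ + s * k + t ≡ toℕ α modulo n → t ≡ toℕ β modulo m →
                    vert C α ⊗ vert C′ β ≡ orbit s t
  vert⊗vert≡orbit p q = cong₂ _⊗_ (sym (W.walk-vert p)) (sym (W′.walk-vert q))

  next⊗next≡orbit : ∀ {α β s t} → c₀ + s * k + t ≡ toℕ α modulo n → t ≡ toℕ β modulo m →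
                    vert C (next α) ⊗ vert C′ (next β) ≡ orbit s (suc t)
  next⊗next≡orbit {s = s} {t} p q =
    cong₂ _⊗_ (sym (trans (cong walk (+-suc (c₀ + s * k) t)) (W.walk-suc-vert p))) (sym (W′.walk-suc-vert q))

  arc⇒orbit-arc : ∀ {u w} → ProdArc C C′ u w →
                  ∃ λ s → s < d × ∃ λ t → u ≡ orbit s t × w ≡ orbit s (suc t)
  arc⇒orbit-arc {_ , _ , _} {_ , _ , _} ((α , e₁ , e₂) , (β , e₃ , e₄)) =
    let s , s<d , t , p , q = orbit-index-surjective c₀ α≡c₀+β
    in s , s<d , t , trans (cong₂ _⊗_ e₁ e₃) (vert⊗vert≡orbit {s = s} {t} p q)
                   , trans (cong₂ _⊗_ e₂ e₄) (next⊗next≡orbit {s = s} {t} p q)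
    where
    α≡c₀+β : toℕ α ≡ c₀ + toℕ β modulo k
    α≡c₀+β = same-part⁻¹ (trans (cong proj₂ (W.walk-vert ≡-mod-refl)) (trans (cong proj₂ (sym e₁))
                                (trans (cong proj₂ e₃) (cong proj₂ (sym (W′.walk-vert ≡-mod-refl))))))

  instance
    lcm-nonZero : NonZero L
    lcm-nonZero = m*n≢0⇒n≢0 (gcd n m) ⦃ subst NonZero (sym (gcd*lcm n m)) (m*n≢0 n m) ⦄

  cycleVertex : Fin d × Fin L → PVtx x y k
  cycleVertex (s , j) = orbit (toℕ s) (toℕ j)

  cycleVertex-injective : Injective _≡_ _≡_ cycleVertex
  cycleVertex-injective {s , j} {s′ , j′} e =
    let s≡s′ , j≡j′ = orbit-injective (toℕ<n s) (toℕ<n s′) e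
    in cong₂ _,_ (toℕ-injective s≡s′) (toℕ-injective (≡-mod-<⇒≡ j≡j′ (toℕ<n j) (toℕ<n j′)))

  cycleVertex-orbit : ∀ {a j s t} → toℕ a ≡ s → toℕ j ≡ t modulo L → cycleVertex (a , j) ≡ orbit s t
  cycleVertex-orbit {a} refl j≡t = orbit-cong (toℕ a) j≡t

  cycleVertex-arc : ∀ s j → ProdArc C C′ (cycleVertex (s , j)) (cycleVertex (s , next j))
  cycleVertex-arc s j = subst (ProdArc C C′ (cycleVertex (s , j))) (sym next≡) (orbit-arc (toℕ s) (toℕ j))
    where
    next≡ : cycleVertex (s , next j) ≡ orbit (toℕ s) (suc (toℕ j))
    next≡ = cycleVertex-orbit {s} refl (toℕ-next j)

  arc⇒cycleVertex-arc : ∀ {u w} → ProdArc C C′ u w →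
                        ∃₂ λ s j → u ≡ cycleVertex (s , j) × w ≡ cycleVertex (s , next j)
  arc⇒cycleVertex-arc arc =
    let s , s<d , t , u≡ , w≡ = arc⇒orbit-arc arc
    in fromℕ< s<d , t mod L ,
       trans u≡ (sym (cycleVertex-orbit {s = s} {t} (toℕ-fromℕ< s<d) (toℕ-mod-≡-mod t))) ,
       trans w≡ (sym (cycleVertex-orbit {s = s} {suc t} (toℕ-fromℕ< s<d)
                       (≡-mod-trans (toℕ-next (t mod L)) (≡-mod-+-congˡ 1 (toℕ-mod-≡-mod t)))))

-- Definitionally sends inj₁ zero to inj₂ t and inj₁ (suc i) to inj₁ i.
pivot : ∀ {a r} → Fin (suc r) → (Fin (suc a) ⊎ Fin r) ↔ (Fin a ⊎ Fin (suc r))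
pivot {a} {r} t = begin
  (Fin (suc a) ⊎ Fin r)        ↔⟨ +↔⊎ {1} ⊎-cong ↔-refl ⟩
  ((Fin 1 ⊎ Fin a) ⊎ Fin r)    ↔⟨ ⊎-comm _ _ ⊎-cong ↔-refl ⟩
  ((Fin a ⊎ Fin 1) ⊎ Fin r)    ↔⟨ ⊎-assoc 0ℓ _ _ _ ⟩
  (Fin a ⊎ (Fin 1 ⊎ Fin r))    ↔⟨ ↔-refl ⊎-cong ↔-sym +↔⊎ ⟩
  (Fin a ⊎ Fin (suc r))        ↔⟨ ↔-refl ⊎-cong transpose zero t ⟩
  (Fin a ⊎ Fin (suc r))        ∎
  where open EquationalReasoning

extend-Fin-injection : ∀ {B : Set} {N} a → Fin N ↔ B → (f : Fin a → B) → Injective _≡_ _≡_ f →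
  ∃ λ r → r + a ≡ N × Σ ((Fin a ⊎ Fin r) ↔ B) λ h → ∀ i → Inverse.to h (inj₁ i) ≡ f i
extend-Fin-injection {N = N} zero e f _ = N , +-identityʳ N , ↔-trans (↔-sym (+↔⊎ {0})) e , λ ()
extend-Fin-injection (suc a) e f f-inj
  with extend-Fin-injection a e (f ∘ suc) (suc-injective ∘ f-inj)
... | r , r+a≡N , h , h-extends with Inverse.from h (f zero) in eq
...   | inj₁ i = contradiction (f-inj (trans (sym (Inverse.inverseˡ h (sym eq))) (h-extends i))) 0≢1+n
extend-Fin-injection (suc a) e f f-inj | suc r , r+a≡N , h , h-extends | inj₂ t =
  r , trans (+-suc r a) r+a≡N , ↔-trans (pivot t) h , extends
  where
  extends : ∀ i → Inverse.to h (Inverse.to (pivot t) (inj₁ i)) ≡ f i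
  extends zero    = Inverse.inverseˡ h (sym eq)
  extends (suc i) = h-extends i

extend-injection : ∀ {A B : Set} {a N} → Fin a ↔ A → Fin N ↔ B → (f : A → B) → Injective _≡_ _≡_ f →
  ∃ λ r → r + a ≡ N × Σ ((A ⊎ Fin r) ↔ B) λ h → ∀ x → Inverse.to h (inj₁ x) ≡ f x
extend-injection {a = a} eA eB f f-inj
  with extend-Fin-injection a eB (f ∘ Inverse.to eA) (Injection.injective (↔⇒↣ eA) ∘ f-inj)
... | r , r+a≡N , h , h-extends =
  r , r+a≡N , ↔-trans (↔-sym eA ⊎-cong ↔-refl) h ,
  λ x → trans (h-extends (Inverse.from eA x)) (cong f (Inverse.strictlyInverseˡ eA x))

Fin↔PVtx : ∀ {x y k} → Fin (x * y * k) ↔ PVtx x y k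
Fin↔PVtx {x} {y} {k} = begin
  Fin (x * y * k)               ↔⟨ *↔× ⟩
  (Fin (x * y) × Fin k)         ↔⟨ *↔× ×-cong ↔-refl ⟩
  ((Fin x × Fin y) × Fin k)     ↔⟨ Σ-assoc ⟩
  PVtx x y k                    ∎
  where open EquationalReasoning

lemma4p2 : (x y k n m : ℕ) → 1 ≤ x → 1 ≤ y → 3 ≤ k →
    (C : DiCycle x k n) (C' : DiCycle y k m) →
    ∃₂ λ (d L : ℕ) → ∃₂ λ (q r : ℕ) →
      d * k ≡ gcd n m × L * gcd n m ≡ n * m ×
      q * k ≡ n * m × r + q ≡ x * y * k ×
      ∃ λ (φ : ((Fin d × Fin L) ⊎ Fin r) ⤖ PVtx x y k) →
        ∀ u w → (ProdArc C C' u w →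
                   ∃₂ λ a j → u ≡ Bijection.to φ (inj₁ (a , j))
                            × w ≡ Bijection.to φ (inj₁ (a , next j)))
              × (∀ a j → u ≡ Bijection.to φ (inj₁ (a , j))
                       → w ≡ Bijection.to φ (inj₁ (a , next j))
                       → ProdArc C C' u w)
-- x, y ≥ 1 are implied by the cycles themselves, and k ≥ 3 is only needed as k ≠ 0.
lemma4p2 x y k n m _ _ 3≤k C C′ =
  let r , r+dL≡xyk , φ , φ-extends =
        extend-injection *↔× Fin↔PVtx cycleVertex cycleVertex-injective
  in d , L , d * L , r , d*k≡gcd , L*gcd≡n*m , d*L*k≡n*m , r+dL≡xyk , ↔⇒⤖ φ , λ u w →
       (λ arc → let a , j , u≡ , w≡ = arc⇒cycleVertex-arc arc
                in a , j , trans u≡ (sym (φ-extends _)) , trans w≡ (sym (φ-extends _)))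
     , (λ a j u≡ w≡ → subst₂ (ProdArc C C′) (sym (trans u≡ (φ-extends _))) (sym (trans w≡ (φ-extends _)))
                               (cycleVertex-arc a j))
  where
  instance
    k-nonZero : NonZero k
    k-nonZero = >-nonZero (≤-trans (s≤s z≤n) 3≤k)
  open Orbits C C′
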